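{- Define polynomials $F_n(y)$ by $F_0(y)=y$ and $F_{n+1}(y)=(1+y^2)F_n(y)+y(1+y^2)F_n'(y)$ for $n\ge0$ (equivalently, $F_n$ is the polynomial in $y=\tan x$ with $(Dy)^n(y)=F_n(y)$, where $D=d/dx$ and $(Dy)^{n+1}(f)=D(y\,(Dy)^n(f))$), and set $a_n(y)=2^{ -n}F_n(y)$. Then for every $n\ge1$, $$a_n(y)=\sum_{k=1}^nA(n,k)\,y^{2n-2k+1}(1+y^2)^k,$$ where $A(n,k)$ are the Eulerian numbers.
   Context: The Eulerian number $A(n,k)$ is the number of permutations of $\{1,\dots,n\}$ with exactly $k-1$ descents (positions $i$ with $\pi(i)>\pi(i+1)$). -}

module Defs where

open import Data.Nat using (ℕ; zero; suc; _+_; _*_; _∸_; _^_; _<ᵇ_; _≟_)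
open import Data.Nat.Properties using (m^n≢0)
open import Data.Bool using (if_then_else_)
open import Data.List using (List; []; _∷_; map; concatMap; upTo; length; filter)
open import Data.List.Relation.Unary.Unique.DecPropositional _≟_ using (unique?)
open import Data.Integer using (+_)
open import Data.Rational using (ℚ) renaming (_/_ to _÷_)

-- A permutation of {1,…,n} is represented as its one-line word
-- π(1) … π(n): a list of length n, entries in {1,…,n}, pairwise distinct.

words : ℕ → ℕ → List (List ℕ)
words n zero    = [] ∷ []
words n (suc m) = concatMap (λ w → map (_∷ w) (map suc (upTo n))) (words n m)

perms : ℕ → List (List ℕ)
perms n = filter unique? (words n n)

des : List ℕ → ℕ
des []           = 0
des (x ∷ [])     = 0
des (x ∷ y ∷ r)  = (if y <ᵇ x then 1 else 0) + des (y ∷ r)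

-- Eulerian number A(n,k)  (used for k ≥ 1)
A : ℕ → ℕ → ℕ
A n k = length (filter (λ p → des p ≟ k ∸ 1) (perms n))

-- Polynomials in y with natural-number coefficients, represented by
-- their coefficient function (p j = coefficient of y^j).

Poly : Set
Poly = ℕ → ℕ

sumTo : ℕ → (ℕ → ℕ) → ℕ
sumTo zero    f = 0
sumTo (suc n) f = sumTo n f + f n

const : ℕ → Poly
const c zero    = c
const c (suc j) = 0

Y : Poly
Y zero          = 0
Y (suc zero)    = 1
Y (suc (suc j)) = 0

_⊕_ : Poly → Poly → Poly
(p ⊕ q) j = p j + q j

_⊗_ : Poly → Poly → Poly
(p ⊗ q) j = sumTo (suc j) (λ i → p i * q (j ∸ i))

infixl 6 _⊕_
infixl 7 _⊗_

_^ₚ_ : Poly → ℕ → Poly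
p ^ₚ zero  = const 1
p ^ₚ suc n = p ⊗ (p ^ₚ n)

deriv : Poly → Poly
deriv p j = suc j * p (suc j)

onePlusY² : Poly
onePlusY² = const 1 ⊕ Y ^ₚ 2

F : ℕ → Poly
F zero    = Y
F (suc n) = onePlusY² ⊗ F n ⊕ Y ⊗ onePlusY² ⊗ deriv (F n)

a : ℕ → ℕ → ℚ
a n j = (+ F n j) ÷ (2 ^ n)
  where instance _ = m^n≢0 2 n

eulerSum : ℕ → Poly
eulerSum n j =
  sumTo n (λ i → let k = suc i in
    (const (A n k) ⊗ Y ^ₚ (2 * n ∸ 2 * k + 1) ⊗ onePlusY² ^ₚ k) j)

module Submission where

-- The same permutations are enumerated a second time by inserting n+1 into
-- every position of every permutation of {1,…,n} (perms↭insPerms).  Inserting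
-- a new maximum into a word of length L with δ descents yields δ+1 words with
-- δ descents and L-δ words with δ+1 descents (insertion-descents); counting
-- multiplicities gives the Eulerian recurrence
--   A(n+1,k+1) = (k+1) A(n,k+1) + (n-k+1) A(n,k)          (A-eulerian).
--
-- Polynomials are coefficient functions; write Q = 1 + y².
-- The defining recursion is F_{n+1} = step F_n with step p = Q (p + y p')
-- (F-suc), and from y Q (Q^k)' = 2k y² Q^k one gets the action on the basis
--   step (y^m Q^k) = (m+1) y^m Q^(k+1) + 2k y^(m+2) Q^k      (step-basis).
-- Applied to the Eulerian sum E_n this turns the Eulerian recurrence into
-- step E_{n+1} = 2 E_{n+2} (step-eulerPoly-suc), so F_n = 2^n E_n by
-- induction, and the theorem follows by cancelling 2^n.

open import Defs
open import Data.Nat using (ℕ; zero; suc; _+_; _*_; _∸_; _^_; _≤_; _<_; z≤n; s≤s; _≟_; _<ᵇ_; NonZero)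
open import Data.Nat.Properties
open import Data.Nat.Tactic.RingSolver using (solve-∀)
open import Data.Bool using (Bool; true; false; if_then_else_)
open import Data.List using (List; []; _∷_; [_]; map; concatMap; upTo; length; filter; _++_; replicate)
open import Data.List.Properties using (∷-injectiveˡ; map-++; map-replicate; map-id; length-++; filter-++; filter-accept; filter-reject; map-concatMap; concatMap-map)
open import Data.List.Relation.Unary.All as All using (All; []; _∷_)
open import Data.List.Relation.Unary.Any using (here; there)
open import Data.List.Relation.Unary.AllPairs using ([]; _∷_)
open import Data.List.Membership.Propositional using (_∈_; _∉_; find; lose)
open import Data.List.Membership.Propositional.Properties using (∈-map⁺; ∈-map⁻; ∈-filter⁺; ∈-filter⁻; ∈-upTo⁺; ∈-upTo⁻; ∈-concatMap⁺; ∈-concatMap⁻)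
open import Data.List.Membership.Propositional.Properties.WithK using (unique∧set⇒bag)
open import Data.List.Membership.DecPropositional _≟_ using (_∈?_)
open import Data.List.Relation.Unary.Unique.Propositional using (Unique)
import Data.List.Relation.Unary.Unique.Propositional.Properties as Unique
open import Data.List.Relation.Unary.Unique.DecPropositional _≟_ using (unique?)
open import Data.List.Relation.Binary.Permutation.Propositional using (_↭_; prep; ↭-refl; ↭-trans; ↭-sym; ↭-reflexive)
import Data.List.Relation.Binary.Permutation.Propositional.Properties as ↭
open import Data.List.Relation.Binary.BagAndSetEquality using (∼bag⇒↭)
open import Data.Product using (∃; _×_; _,_; proj₁; proj₂)
open import Data.Sum using (_⊎_; inj₁; inj₂; [_,_]′; map₂)
open import Data.Empty using (⊥; ⊥-elim)
open import Data.Integer using (+_)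
open import Data.Integer.Properties using (pos-*)
open import Data.Rational using (_/_)
open import Data.Rational.Properties using (/-cong; fromℚᵘ-cong)
open import Data.Rational.Unnormalised using (mkℚᵘ; *≡*)
open import Relation.Nullary using (yes; no)
open import Relation.Binary.PropositionalEquality using (_≡_; _≢_; _≗_; refl; sym; trans; cong; cong₂; subst; module ≡-Reasoning)
open import Function using (_∘_)
open import Function.Bundles using (mk⇔)

∈-concatMap-witness : ∀ {A B : Set} (f : A → List B) {xs : List A} {z : B} →
                      z ∈ concatMap f xs → ∃ λ x → x ∈ xs × z ∈ f x
∈-concatMap-witness f z∈ = find (∈-concatMap⁻ f z∈)

∈-concatMap-intro : ∀ {A B : Set} (f : A → List B) {xs : List A} {x : A} {z : B} →
                    x ∈ xs → z ∈ f x → z ∈ concatMap f xs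
∈-concatMap-intro f x∈ z∈ = ∈-concatMap⁺ f (lose x∈ z∈)

-- concatMap f xs is duplicate-free if xs and every f x are, and the blocks
-- f x are pairwise disjoint because g recovers x from any element of f x.
concatMap-unique : ∀ {A B : Set} (g : B → A) (f : A → List B) (xs : List A) → Unique xs →
                   (∀ {x} → x ∈ xs → Unique (f x)) →
                   (∀ {x z} → x ∈ xs → z ∈ f x → g z ≡ x) → Unique (concatMap f xs)
concatMap-unique g f [] _ _ _ = []
concatMap-unique g f (x ∷ xs) (x∉xs ∷ xs!) f! g∘f =
  Unique.++⁺ (f! (here refl))
             (concatMap-unique g f xs xs! (λ m → f! (there m)) (λ m → g∘f (there m)))
             disjoint
  where
  disjoint : ∀ {z} → z ∈ f x × z ∈ concatMap f xs → ⊥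
  disjoint (z∈fx , z∈rest) with ∈-concatMap-witness f z∈rest
  ... | x′ , x′∈xs , z∈fx′ = All.lookup x∉xs x′∈xs (trans (sym (g∘f (here refl) z∈fx)) (g∘f (there x′∈xs) z∈fx′))

insertions : ℕ → List ℕ → List (List ℕ)
insertions x []       = (x ∷ []) ∷ []
insertions x (y ∷ ys) = (x ∷ y ∷ ys) ∷ map (y ∷_) (insertions x ys)

delete : ℕ → List ℕ → List ℕ
delete x []      = []
delete x (h ∷ t) with h ≟ x
... | yes _ = t
... | no _  = h ∷ delete x t

module _ (x : ℕ) where

  insertions-length : ∀ p {z} → z ∈ insertions x p → length z ≡ suc (length p)
  insertions-length []       (here refl) = refl
  insertions-length (y ∷ ys) (here refl) = refl
  insertions-length (y ∷ ys) (there z∈) with ∈-map⁻ (y ∷_) z∈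
  ... | w , w∈ , refl = cong suc (insertions-length ys w∈)

  insertions-entries : ∀ p {z v} → z ∈ insertions x p → v ∈ z → v ≡ x ⊎ v ∈ p
  insertions-entries []       (here refl) (here refl) = inj₁ refl
  insertions-entries (y ∷ ys) (here refl) (here refl) = inj₁ refl
  insertions-entries (y ∷ ys) (here refl) (there v∈) = inj₂ v∈
  insertions-entries (y ∷ ys) (there z∈) v∈ with ∈-map⁻ (y ∷_) z∈
  insertions-entries (y ∷ ys) (there z∈) (here refl) | w , w∈ , refl = inj₂ (here refl)
  insertions-entries (y ∷ ys) (there z∈) (there v∈) | w , w∈ , refl =
    map₂ there (insertions-entries ys w∈ v∈)

  insertions-unique-entries : ∀ p {z} → x ∉ p → Unique p → z ∈ insertions x p → Unique z
  insertions-unique-entries []       x∉p p! (here refl) = [] ∷ []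
  insertions-unique-entries (y ∷ ys) x∉p p! (here refl) =
    All.tabulate (λ v∈ x≡v → x∉p (subst (_∈ y ∷ ys) (sym x≡v) v∈)) ∷ p!
  insertions-unique-entries (y ∷ ys) x∉p (y∉ys ∷ ys!) (there z∈) with ∈-map⁻ (y ∷_) z∈
  ... | w , w∈ , refl =
    All.tabulate (λ v∈w y≡v → [ (λ v≡x → x∉p (here (sym (trans y≡v v≡x))))
                              , (λ v∈ys → All.lookup y∉ys v∈ys y≡v) ]′
                              (insertions-entries ys w∈ v∈w))
    ∷ insertions-unique-entries ys (λ x∈ys → x∉p (there x∈ys)) ys! w∈

  delete-insertion : ∀ p {z} → x ∉ p → z ∈ insertions x p → delete x z ≡ p
  delete-insertion []       x∉p (here refl) with x ≟ x
  ... | yes _  = refl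
  ... | no x≢x = ⊥-elim (x≢x refl)
  delete-insertion (y ∷ ys) x∉p (here refl) with x ≟ x
  ... | yes _  = refl
  ... | no x≢x = ⊥-elim (x≢x refl)
  delete-insertion (y ∷ ys) x∉p (there z∈) with ∈-map⁻ (y ∷_) z∈
  ... | w , w∈ , refl with y ≟ x
  ... | yes y≡x = ⊥-elim (x∉p (here (sym y≡x)))
  ... | no _    = cong (y ∷_) (delete-insertion ys (λ x∈ys → x∉p (there x∈ys)) w∈)

  insertions-unique : ∀ p → x ∉ p → Unique (insertions x p)
  insertions-unique []       x∉p = [] ∷ []
  insertions-unique (y ∷ ys) x∉p =
    All.tabulate first≢rest
    ∷ Unique.map⁺ (λ { refl → refl }) (insertions-unique ys (λ x∈ys → x∉p (there x∈ys)))
    where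
    -- every later insertion starts with y, which differs from x
    first≢rest : ∀ {v} → v ∈ map (y ∷_) (insertions x ys) → (x ∷ y ∷ ys) ≢ v
    first≢rest v∈ eq with ∈-map⁻ (y ∷_) v∈
    ... | w , _ , refl = x∉p (here (∷-injectiveˡ eq))

  insertion-delete : ∀ z → x ∈ z → z ∈ insertions x (delete x z)
  insertion-delete (h ∷ t) x∈z with h ≟ x
  insertion-delete (h ∷ []) x∈z | yes refl = here refl
  insertion-delete (h ∷ _ ∷ _) x∈z | yes refl = here refl
  insertion-delete (h ∷ t) (here x≡h) | no h≢x = ⊥-elim (h≢x (sym x≡h))
  insertion-delete (h ∷ t) (there x∈t) | no h≢x = there (∈-map⁺ (h ∷_) (insertion-delete t x∈t))

  delete-length : ∀ z → x ∈ z → length z ≡ suc (length (delete x z))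
  delete-length (h ∷ t) x∈z with h ≟ x
  ... | yes _ = refl
  delete-length (h ∷ t) (here x≡h)  | no h≢x = ⊥-elim (h≢x (sym x≡h))
  delete-length (h ∷ t) (there x∈t) | no h≢x = cong suc (delete-length t x∈t)

  delete-⊆ : ∀ z {v} → v ∈ delete x z → v ∈ z
  delete-⊆ (h ∷ t) v∈ with h ≟ x
  ... | yes _ = there v∈
  delete-⊆ (h ∷ t) (here v≡h) | no _ = here v≡h
  delete-⊆ (h ∷ t) (there v∈) | no _ = there (delete-⊆ t v∈)

  delete-unique : ∀ z → Unique z → Unique (delete x z)
  delete-unique [] _ = []
  delete-unique (h ∷ t) (h∉t ∷ t!) with h ≟ x
  ... | yes _ = t!
  ... | no _  = All.tabulate (λ v∈ → All.lookup h∉t (delete-⊆ t v∈)) ∷ delete-unique t t!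

  delete-∉ : ∀ z → Unique z → x ∉ delete x z
  delete-∉ (h ∷ t) (h∉t ∷ t!) x∈ with h ≟ x
  delete-∉ (h ∷ t) (h∉t ∷ t!) x∈ | yes refl = All.lookup h∉t x∈ refl
  delete-∉ (h ∷ t) (h∉t ∷ t!) (here x≡h) | no h≢x = h≢x (sym x≡h)
  delete-∉ (h ∷ t) (h∉t ∷ t!) (there x∈) | no h≢x = delete-∉ t t! x∈

InRange : ℕ → ℕ → Set
InRange n v = 1 ≤ v × v ≤ n

IsPerm : ℕ → List ℕ → Set
IsPerm n z = length z ≡ n × All (InRange n) z × Unique z

extend : ℕ → List ℕ → List (List ℕ)
extend n w = map (_∷ w) (map suc (upTo n))

words-complete : ∀ n m z → length z ≡ m → All (InRange n) z → z ∈ words n m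
words-complete n zero    []          _   []                  = here refl
words-complete n (suc m) (suc h ∷ t) len ((_ , h<n) ∷ t-ok) =
  ∈-concatMap-intro (extend n) (words-complete n m t (suc-injective len) t-ok)
                    (∈-map⁺ (_∷ t) (∈-map⁺ suc (∈-upTo⁺ h<n)))

words-sound : ∀ n m {z} → z ∈ words n m → length z ≡ m × All (InRange n) z
words-sound n zero (here refl) = refl , []
words-sound n (suc m) z∈ with ∈-concatMap-witness (extend n) {words n m} z∈
... | w , w∈ , hw∈ with ∈-map⁻ (_∷ w) hw∈
... | h , h∈ , refl with ∈-map⁻ suc h∈
... | i , i∈ , refl with words-sound n m w∈
... | len , w-ok = cong suc len , (s≤s z≤n , ∈-upTo⁻ i∈) ∷ w-ok

-- words n m lists each word once: words are told apart by their tails and first letters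
words-unique : ∀ n m → Unique (words n m)
words-unique n zero    = [] ∷ []
words-unique n (suc m) =
  concatMap-unique tail (extend n) (words n m) (words-unique n m)
    (λ _ → Unique.map⁺ ∷-injectiveˡ (Unique.map⁺ suc-injective (Unique.upTo⁺ n)))
    tail-extend
  where
  tail : List ℕ → List ℕ
  tail []      = []
  tail (_ ∷ t) = t
  tail-extend : ∀ {w z} → w ∈ words n m → z ∈ extend n w → tail z ≡ w
  tail-extend {w} _ z∈ with ∈-map⁻ (_∷ w) z∈
  ... | _ , _ , refl = refl

perms-unique : ∀ n → Unique (perms n)
perms-unique n = Unique.filter⁺ unique? (words-unique n n)

-- A second enumeration of the permutations of {1,…,n}: insert n + 1 in
-- every position of every permutation of {1,…,n}.  This is the
-- enumeration along which descents can be tracked.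
insPerms : ℕ → List (List ℕ)
insPerms zero    = [] ∷ []
insPerms (suc n) = concatMap (insertions (suc n)) (insPerms n)

All-InRange-pred : ∀ n z → All (InRange (suc n)) z → suc n ∉ z → All (InRange n) z
All-InRange-pred n z z-ok n+1∉z = All.tabulate λ {v} v∈z →
  let (1≤v , v≤n+1) = All.lookup z-ok v∈z
  in 1≤v , ≤-pred (≤∧≢⇒< v≤n+1 (λ v≡n+1 → n+1∉z (subst (_∈ z) v≡n+1 v∈z)))

InRange-fresh : ∀ n {p} → All (InRange n) p → suc n ∉ p
InRange-fresh n p-ok n+1∈p = n≮n n (proj₂ (All.lookup p-ok n+1∈p))

insPerms-sound : ∀ n {z} → z ∈ insPerms n → IsPerm n z
insPerms-sound zero (here refl) = refl , [] , []
insPerms-sound (suc n) z∈ with ∈-concatMap-witness (insertions (suc n)) z∈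
... | p , p∈ , z∈ins with insPerms-sound n p∈
... | len , p-ok , p! =
  trans (insertions-length (suc n) p z∈ins) (cong suc len) ,
  All.tabulate (λ v∈z → [ (λ { refl → s≤s z≤n , ≤-refl })
                        , (λ v∈p → let (1≤v , v≤n) = All.lookup p-ok v∈p in 1≤v , m≤n⇒m≤1+n v≤n) ]′
                        (insertions-entries (suc n) p z∈ins v∈z)) ,
  insertions-unique-entries (suc n) p (InRange-fresh n p-ok) p! z∈ins

-- insPerms lists each permutation once: deleting n + 1 recovers the permutation it came from
insPerms-unique : ∀ n → Unique (insPerms n)
insPerms-unique zero    = [] ∷ []
insPerms-unique (suc n) =
  concatMap-unique (delete (suc n)) (insertions (suc n)) (insPerms n) (insPerms-unique n)
    (λ p∈ → insertions-unique (suc n) _ (fresh p∈))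
    (λ p∈ z∈ → delete-insertion (suc n) _ (fresh p∈) z∈)
  where
  fresh : ∀ {p} → p ∈ insPerms n → suc n ∉ p
  fresh p∈ = InRange-fresh n (proj₁ (proj₂ (insPerms-sound n p∈)))

delete-max : ∀ m z → All (InRange (suc m)) z → Unique z →
             All (InRange m) (delete (suc m) z) × Unique (delete (suc m) z)
delete-max m z z-ok z! =
  All-InRange-pred m _ (All.tabulate (λ v∈ → All.lookup z-ok (delete-⊆ (suc m) z v∈)))
                       (delete-∉ (suc m) z z!) ,
  delete-unique (suc m) z z!

unique-length-≤ : ∀ m z → Unique z → All (InRange m) z → length z ≤ m
unique-length-≤ zero    []      _ _                    = z≤n
unique-length-≤ zero    (_ ∷ _) _ ((1≤v , v≤0) ∷ _)    = ⊥-elim (n≮n 0 (≤-trans 1≤v v≤0))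
unique-length-≤ (suc m) z z! z-ok with suc m ∈? z
... | no m+1∉z = m≤n⇒m≤1+n (unique-length-≤ m z z! (All-InRange-pred m z z-ok m+1∉z))
... | yes m+1∈z =
  let (rest-ok , rest!) = delete-max m z z-ok z!
  in subst (_≤ suc m) (sym (delete-length (suc m) z m+1∈z))
           (s≤s (unique-length-≤ m _ rest! rest-ok))

-- every permutation of {1,…,n+1} arises from deleting n + 1 and inserting it back
insPerms-complete : ∀ n z → IsPerm n z → z ∈ insPerms n
insPerms-complete zero    [] _ = here refl
insPerms-complete (suc n) z (len , z-ok , z!) with suc n ∈? z
... | no n+1∉z =
  ⊥-elim (n≮n n (subst (_≤ n) len (unique-length-≤ n z z! (All-InRange-pred n z z-ok n+1∉z))))
... | yes n+1∈z =
  let (rest-ok , rest!) = delete-max n z z-ok z!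
      rest-len = suc-injective (trans (sym (delete-length (suc n) z n+1∈z)) len)
  in ∈-concatMap-intro (insertions (suc n))
       (insPerms-complete n _ (rest-len , rest-ok , rest!))
       (insertion-delete (suc n) z n+1∈z)

perms↭insPerms : ∀ n → perms n ↭ insPerms n
perms↭insPerms n = ∼bag⇒↭ (unique∧set⇒bag (perms-unique n) (insPerms-unique n) (mk⇔ to from))
  where
  to : ∀ {z} → z ∈ perms n → z ∈ insPerms n
  to z∈ with ∈-filter⁻ unique? z∈
  ... | w∈ , z! with words-sound n n w∈
  ... | len , z-ok = insPerms-complete n _ (len , z-ok , z!)
  from : ∀ {z} → z ∈ insPerms n → z ∈ perms n
  from z∈ with insPerms-sound n z∈
  ... | len , z-ok , z! = ∈-filter⁺ unique? (words-complete n n _ len z-ok) z!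

bit : Bool → ℕ
bit c = if c then 1 else 0

<ᵇ-true : ∀ {m n} → m < n → (m <ᵇ n) ≡ true
<ᵇ-true {m} {n} m<n with m <ᵇ n | <⇒<ᵇ m<n
... | true | _ = refl

<ᵇ-false : ∀ {m n} → m < n → (n <ᵇ m) ≡ false
<ᵇ-false {m} {n} m<n with n <ᵇ m | <ᵇ⇒< n m
... | false | _   = refl
... | true  | n<m = ⊥-elim (<-asym m<n (n<m _))

des-≤ : ∀ y ys → des (y ∷ ys) ≤ length ys
des-≤ y []       = z≤n
des-≤ y (z ∷ zs) with z <ᵇ y
... | true  = s≤s (des-≤ z zs)
... | false = m≤n⇒m≤1+n (des-≤ z zs)

-- The multiset of descent numbers of the L + 1 insertions of a new maximum
-- into a word of length L with δ descents: δ + 1 insertions (at the end or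
-- into a descent) keep δ descents, the other L - δ create one more.
insDes : ℕ → ℕ → List ℕ
insDes L δ = replicate (suc δ) δ ++ replicate (L ∸ δ) (suc δ)

insDes-new-descent : ∀ δ L → δ ≤ L → suc δ ∷ insDes L δ ↭ insDes (suc L) δ
insDes-new-descent δ L δ≤L rewrite +-∸-assoc 1 δ≤L =
  ↭-sym (↭.shift (suc δ) (replicate (suc δ) δ) (replicate (L ∸ δ) (suc δ)))

map-suc-insDes : ∀ L δ → map suc (insDes L δ) ≡ replicate (suc δ) (suc δ) ++ replicate (L ∸ δ) (suc (suc δ))
map-suc-insDes L δ = trans (map-++ suc (replicate (suc δ) δ) _)
                           (cong₂ _++_ (map-replicate suc (suc δ) δ) (map-replicate suc (L ∸ δ) (suc δ)))

-- Prefixing a letter y shifts all descent numbers by the same bit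
-- (whether the old first letter lies below y), and the insertion of the
-- maximum directly before the old first letter creates a new descent.
insDes-prefix : ∀ c δ L {M} → M ↭ insDes L δ → δ ≤ L →
                suc δ ∷ map (_+_ (bit c)) M ↭ insDes (suc L) (bit c + δ)
insDes-prefix true  δ L M↭ δ≤L =
  prep (suc δ) (↭-trans (↭.map⁺ suc M↭) (↭-reflexive (map-suc-insDes L δ)))
insDes-prefix false δ L {M} M↭ δ≤L =
  ↭-trans (prep (suc δ) (↭-trans (↭-reflexive (map-id M)) M↭)) (insDes-new-descent δ L δ≤L)

des-prefix-map : ∀ y z ws → map des (map (y ∷_) (map (z ∷_) ws)) ≡ map (_+_ (bit (z <ᵇ y))) (map des (map (z ∷_) ws))
des-prefix-map y z []       = refl
des-prefix-map y z (w ∷ ws) = cong (_ ∷_) (des-prefix-map y z ws)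

module _ (x : ℕ) where

  descents-after : ∀ y ys → All (_< x) (y ∷ ys) →
                   map des (map (y ∷_) (insertions x ys)) ↭ insDes (length ys) (des (y ∷ ys))
  descents-after y []       (y<x ∷ []) = ↭-reflexive (cong (λ c → bit c + 0 ∷ []) (<ᵇ-false y<x))
  descents-after y (z ∷ zs) (y<x ∷ z<x ∷ zs<x) =
    ↭-trans (↭-reflexive (cong₂ _∷_ x-after-y (des-prefix-map y z (insertions x zs))))
            (insDes-prefix (z <ᵇ y) (des (z ∷ zs)) (length zs)
                           (descents-after z zs (z<x ∷ zs<x)) (des-≤ z zs))
    where
    -- y x z … has a descent at x but not at y
    x-after-y : des (y ∷ x ∷ z ∷ zs) ≡ suc (des (z ∷ zs))
    x-after-y = cong₂ (λ c c′ → bit c + (bit c′ + des (z ∷ zs))) (<ᵇ-false y<x) (<ᵇ-true z<x)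

  insertion-descents : ∀ p → All (_< x) p → map des (insertions x p) ↭ insDes (length p) (des p)
  insertion-descents []       []           = ↭-refl
  insertion-descents (y ∷ ys) (y<x ∷ ys<x) =
    ↭-trans (↭-reflexive (cong (λ c → bit c + des (y ∷ ys) ∷ map des (map (y ∷_) (insertions x ys))) (<ᵇ-true y<x)))
    (↭-trans (prep _ (descents-after y ys (y<x ∷ ys<x)))
             (insDes-new-descent (des (y ∷ ys)) (length ys) (des-≤ y ys)))

concatMap-↭ : ∀ {A B : Set} (f g : A → List B) (xs : List A) →
              (∀ {x} → x ∈ xs → f x ↭ g x) → concatMap f xs ↭ concatMap g xs
concatMap-↭ f g []       _    = ↭-refl
concatMap-↭ f g (x ∷ xs) f↭g = ↭.++⁺ (f↭g (here refl)) (concatMap-↭ f g xs (λ x∈ → f↭g (there x∈)))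

insPerms-descents : ∀ n → map des (insPerms (suc n)) ↭ concatMap (insDes n) (map des (insPerms n))
insPerms-descents n =
  ↭-trans (↭-reflexive (map-concatMap des (insertions (suc n)) (insPerms n)))
  (↭-trans (concatMap-↭ _ _ (insPerms n) insert-max)
           (↭-reflexive (sym (concatMap-map (insDes n) des (insPerms n)))))
  where
  insert-max : ∀ {p} → p ∈ insPerms n → map des (insertions (suc n) p) ↭ insDes n (des p)
  insert-max p∈ with insPerms-sound n p∈
  ... | refl , p-ok , _ = insertion-descents (suc n) _ (All.map (s≤s ∘ proj₂) p-ok)

occ : ℕ → List ℕ → ℕ
occ d xs = length (filter (_≟ d) xs)

occ-++ : ∀ d xs ys → occ d (xs ++ ys) ≡ occ d xs + occ d ys
occ-++ d xs ys = trans (cong length (filter-++ (_≟ d) xs ys)) (length-++ (filter (_≟ d) xs))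

occ-hit : ∀ d → occ d [ d ] ≡ 1
occ-hit d = cong length (filter-accept (_≟ d) refl)

occ-miss : ∀ d v → v ≢ d → occ d [ v ] ≡ 0
occ-miss d v v≢d = cong length (filter-reject (_≟ d) v≢d)

occ-replicate : ∀ d m v → occ d (replicate m v) ≡ m * occ d [ v ]
occ-replicate d zero    v = refl
occ-replicate d (suc m) v = trans (occ-++ d [ v ] (replicate m v)) (cong (_+_ (occ d [ v ])) (occ-replicate d m v))

occ-weight : ∀ (w : ℕ → ℕ) d v → w v * occ d [ v ] ≡ w d * occ d [ v ]
occ-weight w d v with v ≟ d
... | yes refl = refl
... | no v≢d rewrite occ-miss d v v≢d = trans (*-zeroʳ (w v)) (sym (*-zeroʳ (w d)))

occ-suc : ∀ d v → occ (suc d) [ suc v ] ≡ occ d [ v ]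
occ-suc d v with v ≟ d
... | yes refl = trans (occ-hit (suc d)) (sym (occ-hit d))
... | no v≢d   = trans (occ-miss (suc d) (suc v) (v≢d ∘ suc-injective)) (sym (occ-miss d v v≢d))

occ-insDes : ∀ d L δ → occ d (insDes L δ) ≡ suc δ * occ d [ δ ] + (L ∸ δ) * occ d [ suc δ ]
occ-insDes d L δ = trans (occ-++ d (replicate (suc δ) δ) _)
                         (cong₂ _+_ (occ-replicate d (suc δ) δ) (occ-replicate d (L ∸ δ) (suc δ)))

-- an insertion never removes descents, so 0 arises only from 0, once
occ-insDes-zero : ∀ L δ → occ 0 (insDes L δ) ≡ occ 0 [ δ ]
occ-insDes-zero L δ = begin
  occ 0 (insDes L δ)                              ≡⟨ occ-insDes 0 L δ ⟩
  suc δ * occ 0 [ δ ] + (L ∸ δ) * occ 0 [ suc δ ] ≡⟨ cong₂ _+_ (occ-weight suc 0 δ)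
                                                             (cong ((L ∸ δ) *_) (occ-miss 0 (suc δ) λ ())) ⟩
  1 * occ 0 [ δ ] + (L ∸ δ) * 0                   ≡⟨ cong₂ _+_ (*-identityˡ _) (*-zeroʳ (L ∸ δ)) ⟩
  occ 0 [ δ ] + 0                                 ≡⟨ +-identityʳ _ ⟩
  occ 0 [ δ ]                                     ∎
  where open ≡-Reasoning

occ-insDes-suc : ∀ d L δ → occ (suc d) (insDes L δ) ≡ suc (suc d) * occ (suc d) [ δ ] + (L ∸ d) * occ d [ δ ]
occ-insDes-suc d L δ = begin
  occ (suc d) (insDes L δ)                                    ≡⟨ occ-insDes (suc d) L δ ⟩
  suc δ * occ (suc d) [ δ ] + (L ∸ δ) * occ (suc d) [ suc δ ] ≡⟨ cong₂ _+_ (occ-weight suc (suc d) δ)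
                                                                         (cong ((L ∸ δ) *_) (occ-suc d δ)) ⟩
  suc (suc d) * occ (suc d) [ δ ] + (L ∸ δ) * occ d [ δ ]     ≡⟨ cong (_+_ (suc (suc d) * occ (suc d) [ δ ]))
                                                                      (occ-weight (L ∸_) d δ) ⟩
  suc (suc d) * occ (suc d) [ δ ] + (L ∸ d) * occ d [ δ ]     ∎
  where open ≡-Reasoning

occ-↭ : ∀ d {xs ys} → xs ↭ ys → occ d xs ≡ occ d ys
occ-↭ d xs↭ys = ↭.↭-length (↭.filter-↭ (_≟ d) xs↭ys)

occ-∷ : ∀ d x xs → occ d (x ∷ xs) ≡ occ d [ x ] + occ d xs
occ-∷ d x xs = occ-++ d [ x ] xs

occ-concatMap-insDes-zero : ∀ L ds → occ 0 (concatMap (insDes L) ds) ≡ occ 0 ds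
occ-concatMap-insDes-zero L []       = refl
occ-concatMap-insDes-zero L (δ ∷ ds) =
  trans (occ-++ 0 (insDes L δ) (concatMap (insDes L) ds))
  (trans (cong₂ _+_ (occ-insDes-zero L δ) (occ-concatMap-insDes-zero L ds)) (sym (occ-∷ 0 δ ds)))

occ-concatMap-insDes-suc : ∀ d L ds →
  occ (suc d) (concatMap (insDes L) ds) ≡ suc (suc d) * occ (suc d) ds + (L ∸ d) * occ d ds
occ-concatMap-insDes-suc d L []       = sym (cong₂ _+_ (*-zeroʳ (suc (suc d))) (*-zeroʳ (L ∸ d)))
occ-concatMap-insDes-suc d L (δ ∷ ds) = begin
  occ (suc d) (insDes L δ ++ concatMap (insDes L) ds)
    ≡⟨ occ-++ (suc d) (insDes L δ) _ ⟩
  occ (suc d) (insDes L δ) + occ (suc d) (concatMap (insDes L) ds)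
    ≡⟨ cong₂ _+_ (occ-insDes-suc d L δ) (occ-concatMap-insDes-suc d L ds) ⟩
  (α * x₁ + β * y₁) + (α * x₂ + β * y₂)
    ≡⟨ regroup α β x₁ y₁ x₂ y₂ ⟩
  α * (x₁ + x₂) + β * (y₁ + y₂)
    ≡⟨ sym (cong₂ (λ u v → α * u + β * v) (occ-∷ (suc d) δ ds) (occ-∷ d δ ds)) ⟩
  α * occ (suc d) (δ ∷ ds) + β * occ d (δ ∷ ds) ∎
  where
  open ≡-Reasoning
  α β x₁ x₂ y₁ y₂ : ℕ
  α = suc (suc d)
  β = L ∸ d
  x₁ = occ (suc d) [ δ ]
  x₂ = occ (suc d) ds
  y₁ = occ d [ δ ]
  y₂ = occ d ds
  regroup : ∀ a b x₁ y₁ x₂ y₂ → (a * x₁ + b * y₁) + (a * x₂ + b * y₂) ≡ a * (x₁ + x₂) + b * (y₁ + y₂)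
  regroup = solve-∀

-- The Eulerian numbers by their recurrence: eulerian n i = A(n, i + 1).
eulerian : ℕ → ℕ → ℕ
eulerian zero    zero    = 1
eulerian zero    (suc i) = 0
eulerian (suc n) zero    = eulerian n zero
eulerian (suc n) (suc i) = suc (suc i) * eulerian n (suc i) + (n ∸ i) * eulerian n i

occ-map-des : ∀ d L → length (filter (λ p → des p ≟ d) L) ≡ occ d (map des L)
occ-map-des d []      = refl
occ-map-des d (p ∷ L) with des p ≟ d
... | yes hit = trans (cong length (filter-accept (λ q → des q ≟ d) {p} {L} hit))
                (trans (cong suc (occ-map-des d L)) (sym (cong length (filter-accept (_≟ d) {des p} {map des L} hit))))
... | no miss = trans (cong length (filter-reject (λ q → des q ≟ d) {p} {L} miss))
                (trans (occ-map-des d L) (sym (cong length (filter-reject (_≟ d) {des p} {map des L} miss))))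

insPerms-eulerian : ∀ n i → occ i (map des (insPerms n)) ≡ eulerian n i
insPerms-eulerian zero    zero    = refl
insPerms-eulerian zero    (suc i) = refl
insPerms-eulerian (suc n) zero    =
  trans (occ-↭ 0 (insPerms-descents n))
  (trans (occ-concatMap-insDes-zero n (map des (insPerms n))) (insPerms-eulerian n zero))
insPerms-eulerian (suc n) (suc i) =
  trans (occ-↭ (suc i) (insPerms-descents n))
  (trans (occ-concatMap-insDes-suc i n (map des (insPerms n)))
         (cong₂ (λ u v → suc (suc i) * u + (n ∸ i) * v) (insPerms-eulerian n (suc i)) (insPerms-eulerian n i)))

A-eulerian : ∀ n i → A n (suc i) ≡ eulerian n i
A-eulerian n i =
  trans (↭.↭-length (↭.filter-↭ (λ p → des p ≟ i) (perms↭insPerms n)))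
  (trans (occ-map-des i (insPerms n)) (insPerms-eulerian n i))

sumTo-cong : ∀ n {f g : ℕ → ℕ} → (∀ i → i < n → f i ≡ g i) → sumTo n f ≡ sumTo n g
sumTo-cong zero    f≡g = refl
sumTo-cong (suc n) f≡g = cong₂ _+_ (sumTo-cong n (λ i i<n → f≡g i (m<n⇒m<1+n i<n))) (f≡g n ≤-refl)

sumTo-congᵗ : ∀ n {f g : ℕ → ℕ} → f ≗ g → sumTo n f ≡ sumTo n g
sumTo-congᵗ n f≗g = sumTo-cong n (λ i _ → f≗g i)

sumTo-+ : ∀ n (f g : ℕ → ℕ) → sumTo n (λ i → f i + g i) ≡ sumTo n f + sumTo n g
sumTo-+ zero    f g = refl
sumTo-+ (suc n) f g rewrite sumTo-+ n f g = interchange (sumTo n f) (sumTo n g) (f n) (g n)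
  where
  interchange : ∀ a b c d → a + b + (c + d) ≡ a + c + (b + d)
  interchange = solve-∀

sumTo-* : ∀ n c (f : ℕ → ℕ) → sumTo n (λ i → c * f i) ≡ c * sumTo n f
sumTo-* zero    c f = sym (*-zeroʳ c)
sumTo-* (suc n) c f rewrite sumTo-* n c f = sym (*-distribˡ-+ c (sumTo n f) (f n))

sumTo-head : ∀ n (f : ℕ → ℕ) → sumTo (suc n) f ≡ f 0 + sumTo n (λ i → f (suc i))
sumTo-head zero    f = sym (+-identityʳ (f 0))
sumTo-head (suc n) f rewrite sumTo-head n f = +-assoc (f 0) _ _

sumTo-zero : ∀ n (f : ℕ → ℕ) → f ≗ (λ _ → 0) → sumTo n f ≡ 0
sumTo-zero zero    f f≗0 = refl
sumTo-zero (suc n) f f≗0 rewrite sumTo-zero n f f≗0 | f≗0 n = refl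

mulY : Poly → Poly
mulY p zero    = 0
mulY p (suc j) = p j

mulY^ : ℕ → Poly → Poly
mulY^ zero    p = p
mulY^ (suc m) p = mulY (mulY^ m p)

mulY-cong : ∀ {p q} → p ≗ q → mulY p ≗ mulY q
mulY-cong p≗q zero    = refl
mulY-cong p≗q (suc j) = p≗q j

mulY^-cong : ∀ m {p q} → p ≗ q → mulY^ m p ≗ mulY^ m q
mulY^-cong zero    p≗q = p≗q
mulY^-cong (suc m) p≗q = mulY-cong (mulY^-cong m p≗q)

⊗-congˡ : ∀ {p p′} q → p ≗ p′ → p ⊗ q ≗ p′ ⊗ q
⊗-congˡ q p≗p′ j = sumTo-congᵗ (suc j) (λ i → cong (_* q (j ∸ i)) (p≗p′ i))

⊗-distribʳ-⊕ : ∀ p p′ q → (p ⊕ p′) ⊗ q ≗ p ⊗ q ⊕ p′ ⊗ q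
⊗-distribʳ-⊕ p p′ q j =
  trans (sumTo-congᵗ (suc j) (λ i → *-distribʳ-+ (q (j ∸ i)) (p i) (p′ i))) (sumTo-+ (suc j) _ _)

⊗-scaleˡ : ∀ c p q → (λ i → c * p i) ⊗ q ≗ (λ j → c * (p ⊗ q) j)
⊗-scaleˡ c p q j = trans (sumTo-congᵗ (suc j) (λ i → *-assoc c (p i) (q (j ∸ i)))) (sumTo-* (suc j) c _)

const-⊗ : ∀ c q → const c ⊗ q ≗ (λ j → c * q j)
const-⊗ c q j =
  trans (sumTo-head j (λ i → const c i * q (j ∸ i)))
        (trans (cong (_+_ (c * q j)) (sumTo-zero j _ (λ _ → refl))) (+-identityʳ (c * q j)))

one-⊗ : ∀ q → const 1 ⊗ q ≗ q
one-⊗ q j = trans (const-⊗ 1 q j) (*-identityˡ (q j))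

mulY-⊗ : ∀ p q → mulY p ⊗ q ≗ mulY (p ⊗ q)
mulY-⊗ p q zero    = refl
mulY-⊗ p q (suc j) = sumTo-head (suc j) (λ i → mulY p i * q (suc j ∸ i))

mulY^-⊗ : ∀ m p q → mulY^ m p ⊗ q ≗ mulY^ m (p ⊗ q)
mulY^-⊗ zero    p q j = refl
mulY^-⊗ (suc m) p q j = trans (mulY-⊗ (mulY^ m p) q j) (mulY-cong (mulY^-⊗ m p q) j)

Y-is-mulY : Y ≗ mulY (const 1)
Y-is-mulY zero          = refl
Y-is-mulY (suc zero)    = refl
Y-is-mulY (suc (suc j)) = refl

Y-⊗ : ∀ q → Y ⊗ q ≗ mulY q
Y-⊗ q j = trans (⊗-congˡ q Y-is-mulY j) (trans (mulY-⊗ (const 1) q j) (mulY-cong (one-⊗ q) j))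

Y^ₚ-is-mulY^ : ∀ m → Y ^ₚ m ≗ mulY^ m (const 1)
Y^ₚ-is-mulY^ zero    j = refl
Y^ₚ-is-mulY^ (suc m) j = trans (Y-⊗ (Y ^ₚ m) j) (mulY-cong (Y^ₚ-is-mulY^ m) j)

onePlusY²-⊗ : ∀ q → onePlusY² ⊗ q ≗ (λ j → q j + mulY^ 2 q j)
onePlusY²-⊗ q j =
  trans (⊗-distribʳ-⊕ (const 1) (Y ^ₚ 2) q j)
        (cong₂ _+_ (one-⊗ q j)
                   (trans (⊗-congˡ q (Y^ₚ-is-mulY^ 2) j)
                          (trans (mulY^-⊗ 2 (const 1) q j) (mulY^-cong 2 (one-⊗ q) j))))

onePlusY²Pow : ℕ → Poly
onePlusY²Pow zero      = const 1
onePlusY²Pow (suc k) j = onePlusY²Pow k j + mulY^ 2 (onePlusY²Pow k) j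

onePlusY²^ₚ : ∀ k → onePlusY² ^ₚ k ≗ onePlusY²Pow k
onePlusY²^ₚ zero    j = refl
onePlusY²^ₚ (suc k) j =
  trans (onePlusY²-⊗ (onePlusY² ^ₚ k) j)
        (cong₂ _+_ (onePlusY²^ₚ k j) (mulY^-cong 2 (onePlusY²^ₚ k) j))

basis : ℕ → ℕ → Poly
basis m k = mulY^ m (onePlusY²Pow k)

eulerTerm : ∀ c m k → const c ⊗ Y ^ₚ m ⊗ onePlusY² ^ₚ k ≗ (λ j → c * basis m k j)
eulerTerm c m k j = begin
  (const c ⊗ Y ^ₚ m ⊗ Q) j            ≡⟨ ⊗-congˡ Q (λ i → trans (const-⊗ c (Y ^ₚ m) i) (cong (c *_) (Y^ₚ-is-mulY^ m i))) j ⟩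
  ((λ i → c * mulY^ m one i) ⊗ Q) j   ≡⟨ ⊗-scaleˡ c (mulY^ m one) Q j ⟩
  c * (mulY^ m one ⊗ Q) j             ≡⟨ cong (c *_) (mulY^-⊗ m one Q j) ⟩
  c * mulY^ m (one ⊗ Q) j             ≡⟨ cong (c *_) (mulY^-cong m (λ i → trans (one-⊗ Q i) (onePlusY²^ₚ k i)) j) ⟩
  c * basis m k j                     ∎
  where
  open ≡-Reasoning
  Q one : Poly
  Q = onePlusY² ^ₚ k
  one = const 1

-- The recursion F_{n+1} = (1 + y²)(F_n + y F_n') on coefficients:
-- the coefficient of y^j in (1 + y²)(p + y p') is (j+1) p_j + (j-1) p_{j-2}.
step : Poly → Poly
step p zero          = p 0
step p (suc zero)    = 2 * p 1
step p (suc (suc i)) = (3 + i) * p (2 + i) + (1 + i) * p i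

F-suc : ∀ n → F (suc n) ≗ step (F n)
F-suc n j = trans (cong₂ _+_ (onePlusY²-⊗ (F n) j) y-part) (coefficients (F n) j)
  where
  p′ : Poly
  p′ = deriv (F n)
  y-part : (Y ⊗ onePlusY² ⊗ p′) j ≡ mulY (λ i → p′ i + mulY^ 2 p′ i) j
  y-part = trans (⊗-congˡ p′ (Y-⊗ onePlusY²) j)
                 (trans (mulY-⊗ onePlusY² p′ j) (mulY-cong (onePlusY²-⊗ p′) j))
  coefficients : ∀ p j → p j + mulY^ 2 p j + mulY (λ i → deriv p i + mulY^ 2 (deriv p) i) j ≡ step p j
  coefficients p zero = trans (+-identityʳ _) (+-identityʳ _)
  coefficients p (suc zero) = lemma (p 1)
    where lemma : ∀ a → a + 0 + (1 * a + 0) ≡ 2 * a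
          lemma = solve-∀
  coefficients p (suc (suc zero)) = lemma (p 2) (p 0)
    where lemma : ∀ a b → a + b + (2 * a + 0) ≡ 3 * a + 1 * b
          lemma = solve-∀
  coefficients p (suc (suc (suc i))) = lemma i (p (3 + i)) (p (1 + i))
    where lemma : ∀ i a b → a + b + ((3 + i) * a + (1 + i) * b) ≡ (4 + i) * a + (2 + i) * b
          lemma = solve-∀

step-cong : ∀ {p q} → p ≗ q → step p ≗ step q
step-cong p≗q zero          = p≗q 0
step-cong p≗q (suc zero)    = cong (2 *_) (p≗q 1)
step-cong p≗q (suc (suc i)) = cong₂ (λ a b → (3 + i) * a + (1 + i) * b) (p≗q (2 + i)) (p≗q i)

step-sum : ∀ n (c : ℕ → ℕ) (g : ℕ → Poly) →
           step (λ t → sumTo n (λ i → c i * g i t)) ≗ (λ j → sumTo n (λ i → c i * step (g i) j))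
step-sum n c g zero          = refl
step-sum n c g (suc zero)    = trans (sym (sumTo-* n 2 _)) (sumTo-congᵗ n (λ i → swap (c i) (g i 1)))
  where swap : ∀ c a → 2 * (c * a) ≡ c * (2 * a)
        swap = solve-∀
step-sum n c g (suc (suc j)) =
  sym (trans (sumTo-congᵗ n (λ i → distrib j (c i) (g i (2 + j)) (g i j)))
      (trans (sumTo-+ n _ _) (cong₂ _+_ (sumTo-* n (3 + j) _) (sumTo-* n (1 + j) _))))
  where distrib : ∀ j c a b → c * ((3 + j) * a + (1 + j) * b) ≡ (3 + j) * (c * a) + (1 + j) * (c * b)
        distrib = solve-∀

step-scale : ∀ c p → step (λ t → c * p t) ≗ (λ j → c * step p j)
step-scale c p zero          = refl
step-scale c p (suc zero)    = swap c (p 1)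
  where swap : ∀ c a → 2 * (c * a) ≡ c * (2 * a)
        swap = solve-∀
step-scale c p (suc (suc i)) = distrib i c (p (2 + i)) (p i)
  where distrib : ∀ i c a b → (3 + i) * (c * a) + (1 + i) * (c * b) ≡ c * ((3 + i) * a + (1 + i) * b)
        distrib = solve-∀

-- (1 + y²)^k is even: its coefficient of y vanishes
onePlusY²Pow-1 : ∀ k → onePlusY²Pow k 1 ≡ 0
onePlusY²Pow-1 zero = refl
onePlusY²Pow-1 (suc k) rewrite onePlusY²Pow-1 k = refl

-- The derivative of Q = (1 + y²)^k satisfies y (1 + y²) Q' = 2k y² Q;
-- comparing coefficients of y^(i+2):
pow-derivative : ∀ k i → (2 + i) * onePlusY²Pow k (2 + i) + i * onePlusY²Pow k i
                         ≡ 2 * k * onePlusY²Pow k i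
pow-derivative zero    zero    = refl
pow-derivative zero    (suc i) = lemma i
  where lemma : ∀ i → (3 + i) * 0 + (1 + i) * 0 ≡ 2 * 0 * 0
        lemma = solve-∀
pow-derivative (suc k) zero    = lemma k (c 2) (c 0) (pow-derivative k 0)
  where
  c : Poly
  c = onePlusY²Pow k
  lemma : ∀ k c₂ c₀ → 2 * c₂ + 0 * c₀ ≡ 2 * k * c₀ → 2 * (c₂ + c₀) + 0 * (c₀ + 0) ≡ 2 * suc k * (c₀ + 0)
  lemma k c₂ c₀ ih = trans (shape c₂ c₀) (trans (cong (_+ 2 * c₀) ih) (collect k c₀))
    where shape : ∀ c₂ c₀ → 2 * (c₂ + c₀) + 0 * (c₀ + 0) ≡ (2 * c₂ + 0 * c₀) + 2 * c₀
          shape = solve-∀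
          collect : ∀ k c₀ → 2 * k * c₀ + 2 * c₀ ≡ 2 * suc k * (c₀ + 0)
          collect = solve-∀
pow-derivative (suc k) (suc zero) =
  lemma k (onePlusY²Pow k 3) (onePlusY²Pow k 1) (onePlusY²Pow-1 k) (pow-derivative k 1)
  where
  lemma : ∀ k c₃ c₁ → c₁ ≡ 0 → 3 * c₃ + 1 * c₁ ≡ 2 * k * c₁ →
          3 * (c₃ + c₁) + 1 * (c₁ + 0) ≡ 2 * suc k * (c₁ + 0)
  lemma k c₃ .0 refl ih = trans (shape c₃) (trans ih (collect k))
    where shape : ∀ c₃ → 3 * (c₃ + 0) + 1 * (0 + 0) ≡ 3 * c₃ + 1 * 0
          shape = solve-∀
          collect : ∀ k → 2 * k * 0 ≡ 2 * suc k * (0 + 0)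
          collect = solve-∀
pow-derivative (suc k) (suc (suc i)) =
  lemma i k (c (4 + i)) (c (2 + i)) (c i) (pow-derivative k (2 + i)) (pow-derivative k i)
  where
  c : Poly
  c = onePlusY²Pow k
  lemma : ∀ i k c₄ c₂ c₀ → (4 + i) * c₄ + (2 + i) * c₂ ≡ 2 * k * c₂ → (2 + i) * c₂ + i * c₀ ≡ 2 * k * c₀ →
          (4 + i) * (c₄ + c₂) + (2 + i) * (c₂ + c₀) ≡ 2 * suc k * (c₂ + c₀)
  lemma i k c₄ c₂ c₀ ih₂ ih₀ =
    trans (shape i c₄ c₂ c₀) (trans (cong₂ (λ u v → u + v + 2 * c₂ + 2 * c₀) ih₂ ih₀) (collect k c₂ c₀))
    where shape : ∀ i c₄ c₂ c₀ → (4 + i) * (c₄ + c₂) + (2 + i) * (c₂ + c₀)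
                                 ≡ ((4 + i) * c₄ + (2 + i) * c₂) + ((2 + i) * c₂ + i * c₀) + 2 * c₂ + 2 * c₀
          shape = solve-∀
          collect : ∀ k c₂ c₀ → 2 * k * c₂ + 2 * k * c₀ + 2 * c₂ + 2 * c₀ ≡ 2 * suc k * (c₂ + c₀)
          collect = solve-∀

basis-suc : ∀ m k → basis m (suc k) ≗ (λ j → basis m k j + basis (2 + m) k j)
basis-suc zero    k j       = refl
basis-suc (suc m) k zero    = refl
basis-suc (suc m) k (suc j) = basis-suc m k j

step-mulY : ∀ p j → step (mulY p) (suc j) ≡ step p j + (p j + mulY^ 2 p j)
step-mulY p zero          = lemma (p 0)
  where lemma : ∀ a → 2 * a ≡ a + (a + 0)
        lemma = solve-∀
step-mulY p (suc zero)    = lemma (p 1)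
  where lemma : ∀ a → 3 * a + 1 * 0 ≡ 2 * a + (a + 0)
        lemma = solve-∀
step-mulY p (suc (suc i)) = lemma i (p (2 + i)) (p i)
  where lemma : ∀ i a b → (4 + i) * a + (2 + i) * b ≡ (3 + i) * a + (1 + i) * b + (a + b)
        lemma = solve-∀

step-basis : ∀ m k j → step (basis m k) j ≡ suc m * basis m (suc k) j + 2 * k * basis (2 + m) k j
step-basis zero k zero = lemma (onePlusY²Pow k 0) k
  where lemma : ∀ c₀ k → c₀ ≡ 1 * (c₀ + 0) + 2 * k * 0
        lemma = solve-∀
step-basis zero k (suc zero) rewrite onePlusY²Pow-1 k = lemma k
  where lemma : ∀ k → 2 * 0 ≡ 1 * (0 + 0) + 2 * k * 0
        lemma = solve-∀
step-basis zero k (suc (suc i)) =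
  lemma i k (onePlusY²Pow k (2 + i)) (onePlusY²Pow k i) (pow-derivative k i)
  where
  lemma : ∀ i k c₂ c₀ → (2 + i) * c₂ + i * c₀ ≡ 2 * k * c₀ →
          (3 + i) * c₂ + (1 + i) * c₀ ≡ 1 * (c₂ + c₀) + 2 * k * c₀
  lemma i k c₂ c₀ derivative =
    trans (shape i c₂ c₀) (trans (cong (_+_ (c₂ + c₀)) derivative) (collect k c₂ c₀))
    where shape : ∀ i c₂ c₀ → (3 + i) * c₂ + (1 + i) * c₀ ≡ c₂ + c₀ + ((2 + i) * c₂ + i * c₀)
          shape = solve-∀
          collect : ∀ k c₂ c₀ → c₂ + c₀ + 2 * k * c₀ ≡ 1 * (c₂ + c₀) + 2 * k * c₀
          collect = solve-∀
step-basis (suc m) k zero = lemma m k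
  where lemma : ∀ m k → 0 ≡ (2 + m) * 0 + 2 * k * 0
        lemma = solve-∀
step-basis (suc m) k (suc j) = begin
  step (mulY (basis m k)) (suc j)
    ≡⟨ step-mulY (basis m k) j ⟩
  step (basis m k) j + (basis m k j + basis (2 + m) k j)
    ≡⟨ cong₂ _+_ (step-basis m k j) (sym (basis-suc m k j)) ⟩
  suc m * basis m (suc k) j + 2 * k * basis (2 + m) k j + basis m (suc k) j
    ≡⟨ collect m k (basis m (suc k) j) (basis (2 + m) k j) ⟩
  suc (suc m) * basis m (suc k) j + 2 * k * basis (2 + m) k j ∎
  where
  open ≡-Reasoning
  collect : ∀ m k x z → suc m * x + 2 * k * z + x ≡ suc (suc m) * x + 2 * k * z
  collect = solve-∀

-- exponent of y in the i-th term of the Eulerian sum: 2(n - (i+1)) + 1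
yExp : ℕ → ℕ → ℕ
yExp n i = 2 * (n ∸ suc i) + 1

eulerPoly : ℕ → Poly
eulerPoly n j = sumTo n (λ i → eulerian n i * basis (yExp n i) (suc i) j)

eulerSum≗eulerPoly : ∀ n → eulerSum n ≗ eulerPoly n
eulerSum≗eulerPoly n j = sumTo-congᵗ n λ i →
  trans (eulerTerm (A n (suc i)) (2 * n ∸ 2 * suc i + 1) (suc i) j)
        (cong₂ (λ c m → c * basis m (suc i) j) (A-eulerian n i) (cong (_+ 1) (sym (*-distribˡ-∸ 2 n (suc i)))))

∸-suc : ∀ n i → i < n → n ∸ i ≡ suc (n ∸ suc i)
∸-suc (suc n) zero    _         = refl
∸-suc (suc n) (suc i) (s≤s i<n) = ∸-suc n i i<n

yExp-succ : ∀ n i → i < n → suc (yExp n i) ≡ 2 * (n ∸ i)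
yExp-succ n i i<n rewrite ∸-suc n i i<n = lemma (n ∸ suc i)
  where lemma : ∀ k → suc (2 * k + 1) ≡ 2 * suc k
        lemma = solve-∀

yExp-raise : ∀ n i → i < n → yExp (suc n) i ≡ 2 + yExp n i
yExp-raise n i i<n rewrite ∸-suc n i i<n = lemma (n ∸ suc i)
  where lemma : ∀ k → 2 * suc k + 1 ≡ 2 + (2 * k + 1)
        lemma = solve-∀

eulerian-vanish : ∀ n i → n < i → eulerian n i ≡ 0
eulerian-vanish zero    (suc i) _         = refl
eulerian-vanish (suc n) (suc i) (s≤s n<i)
  rewrite eulerian-vanish n (suc i) (m<n⇒m<1+n n<i) | eulerian-vanish n i n<i =
  cong₂ _+_ (*-zeroʳ (suc (suc i))) (*-zeroʳ (n ∸ i))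

eulerian-top : ∀ n → eulerian (suc n) (suc n) ≡ 0
eulerian-top n rewrite eulerian-vanish n (suc n) ≤-refl | n∸n≡0 n =
  cong (_+ 0 * eulerian n n) (*-zeroʳ (suc (suc n)))

-- The two halves of step (eulerPoly N), following the two terms of the
-- Eulerian recurrence: the power of (1 + y²) is kept, resp. raised by one.
keepSum raiseSum : ℕ → Poly
keepSum  N j = sumTo N (λ i → suc i * eulerian N i * basis (2 + yExp N i) (suc i) j)
raiseSum N j = sumTo N (λ i → (N ∸ i) * eulerian N i * basis (yExp N i) (suc (suc i)) j)

step-eulerPoly : ∀ N j → step (eulerPoly N) j ≡ 2 * keepSum N j + 2 * raiseSum N j
step-eulerPoly N j = begin
  step (eulerPoly N) j
    ≡⟨ step-sum N (eulerian N) (λ i → basis (yExp N i) (suc i)) j ⟩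
  sumTo N (λ i → eulerian N i * step (basis (yExp N i) (suc i)) j)
    ≡⟨ sumTo-cong N term ⟩
  sumTo N (λ i → 2 * (suc i * eulerian N i * Z i) + 2 * ((N ∸ i) * eulerian N i * X i))
    ≡⟨ sumTo-+ N _ _ ⟩
  sumTo N (λ i → 2 * (suc i * eulerian N i * Z i)) + sumTo N (λ i → 2 * ((N ∸ i) * eulerian N i * X i))
    ≡⟨ cong₂ _+_ (sumTo-* N 2 _) (sumTo-* N 2 _) ⟩
  2 * keepSum N j + 2 * raiseSum N j ∎
  where
  open ≡-Reasoning
  X Z : ℕ → ℕ
  X i = basis (yExp N i) (suc (suc i)) j
  Z i = basis (2 + yExp N i) (suc i) j
  regroup : ∀ e m c x z → e * (2 * m * x + 2 * c * z) ≡ 2 * (c * e * z) + 2 * (m * e * x)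
  regroup = solve-∀
  term : ∀ i → i < N → eulerian N i * step (basis (yExp N i) (suc i)) j
                       ≡ 2 * (suc i * eulerian N i * Z i) + 2 * ((N ∸ i) * eulerian N i * X i)
  term i i<N = trans (cong (eulerian N i *_) (step-basis (yExp N i) (suc i) j))
              (trans (cong (λ t → eulerian N i * (t * X i + 2 * suc i * Z i)) (yExp-succ N i i<N))
                     (regroup (eulerian N i) (N ∸ i) (suc i) (X i) (Z i)))

-- Reindexing eulerPoly (N + 1) along the Eulerian recurrence.
eulerPoly-suc : ∀ n j → eulerPoly (suc (suc n)) j ≡ keepSum (suc n) j + raiseSum (suc n) j
eulerPoly-suc n j = begin
  sumTo (suc N) (λ i → eulerian (suc N) i * W i)
    ≡⟨ sumTo-head N _ ⟩
  eulerian N 0 * W 0 + sumTo N (λ i → eulerian (suc N) (suc i) * W (suc i))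
    ≡⟨ cong₂ _+_ (cong (_* W 0) (sym (*-identityˡ (eulerian N 0))))
                 (trans (sumTo-congᵗ N recurrence) (sumTo-+ N (λ i → keep′ (suc i)) raise′)) ⟩
  keep′ 0 + (sumTo N (λ i → keep′ (suc i)) + raiseSum N j)
    ≡⟨ sym (+-assoc (keep′ 0) _ _) ⟩
  (keep′ 0 + sumTo N (λ i → keep′ (suc i))) + raiseSum N j
    ≡⟨ cong (_+ raiseSum N j) (sym (sumTo-head N keep′)) ⟩
  (sumTo N keep′ + keep′ N) + raiseSum N j
    ≡⟨ cong (λ t → sumTo N keep′ + t + raiseSum N j) last-vanishes ⟩
  (sumTo N keep′ + 0) + raiseSum N j
    ≡⟨ cong (_+ raiseSum N j) (trans (+-identityʳ _) (sumTo-cong N lower-y)) ⟩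
  keepSum N j + raiseSum N j ∎
  where
  open ≡-Reasoning
  N : ℕ
  N = suc n
  W keep′ raise′ : ℕ → ℕ
  W i = basis (yExp (suc N) i) (suc i) j
  keep′ i = suc i * eulerian N i * W i
  raise′ i = (N ∸ i) * eulerian N i * basis (yExp N i) (suc (suc i)) j
  recurrence : ∀ i → eulerian (suc N) (suc i) * W (suc i)
                     ≡ keep′ (suc i) + raise′ i
  recurrence i = *-distribʳ-+ (W (suc i)) (suc (suc i) * eulerian N (suc i)) ((N ∸ i) * eulerian N i)
  last-vanishes : keep′ N ≡ 0
  last-vanishes = trans (cong (λ t → suc N * t * W N) (eulerian-top n)) (cong (_* W N) (*-zeroʳ (suc N)))
  lower-y : ∀ i → i < N → keep′ i ≡ suc i * eulerian N i * basis (2 + yExp N i) (suc i) j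
  lower-y i i<N = cong (λ m → suc i * eulerian N i * basis m (suc i) j) (yExp-raise N i i<N)

step-eulerPoly-suc : ∀ n j → step (eulerPoly (suc n)) j ≡ 2 * eulerPoly (suc (suc n)) j
step-eulerPoly-suc n j =
  trans (step-eulerPoly (suc n) j)
        (trans (sym (*-distribˡ-+ 2 (keepSum (suc n) j) (raiseSum (suc n) j)))
               (cong (2 *_) (sym (eulerPoly-suc n j))))

F-eulerPoly : ∀ n j → F (suc n) j ≡ 2 ^ suc n * eulerPoly (suc n) j
F-eulerPoly zero j = begin
  F 1 j                                              ≡⟨ F-suc 0 j ⟩
  step Y j                                           ≡⟨ step-cong Y-is-mulY j ⟩
  step (basis 1 0) j                                 ≡⟨ step-basis 1 0 j ⟩
  2 * basis 1 1 j + 2 * 0 * basis 3 0 j              ≡⟨ lemma (basis 1 1 j) (basis 3 0 j) ⟩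
  2 ^ 1 * eulerPoly 1 j                              ∎
  where
  open ≡-Reasoning
  lemma : ∀ x y → 2 * x + 2 * 0 * y ≡ 2 * 1 * (0 + 1 * x)
  lemma = solve-∀
F-eulerPoly (suc n) j = begin
  F (2 + n) j                                        ≡⟨ F-suc (suc n) j ⟩
  step (F (suc n)) j                                 ≡⟨ step-cong (F-eulerPoly n) j ⟩
  step (λ t → 2 ^ suc n * eulerPoly (suc n) t) j     ≡⟨ step-scale (2 ^ suc n) (eulerPoly (suc n)) j ⟩
  2 ^ suc n * step (eulerPoly (suc n)) j             ≡⟨ cong (2 ^ suc n *_) (step-eulerPoly-suc n j) ⟩
  2 ^ suc n * (2 * eulerPoly (2 + n) j)              ≡⟨ lemma (2 ^ suc n) (eulerPoly (2 + n) j) ⟩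
  2 ^ (2 + n) * eulerPoly (2 + n) j                  ∎
  where
  open ≡-Reasoning
  lemma : ∀ a b → a * (2 * b) ≡ 2 * a * b
  lemma = solve-∀

cancel-/ : ∀ m .{{_ : NonZero m}} x → (+ (m * x)) / m ≡ (+ x) / 1
cancel-/ (suc d) x =
  fromℚᵘ-cong {mkℚᵘ (+ (suc d * x)) d} {mkℚᵘ (+ x) 0}
    (*≡* (trans (sym (pos-* (suc d * x) 1)) (trans (cong +_ (lemma d x)) (pos-* x (suc d)))))
  where lemma : ∀ d x → suc d * x * 1 ≡ x * suc d
        lemma = solve-∀

mainTheorem4 : (n : ℕ) → 1 ≤ n → (j : ℕ) → a n j ≡ (+ eulerSum n j) / 1
mainTheorem4 (suc n) _ j = begin
  (+ F (suc n) j) / 2 ^ suc n                        ≡⟨ /-cong (cong +_ (F-eulerPoly n j)) refl ⟩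
  (+ (2 ^ suc n * eulerPoly (suc n) j)) / 2 ^ suc n  ≡⟨ /-cong (cong (λ t → + (2 ^ suc n * t))
                                                                       (sym (eulerSum≗eulerPoly (suc n) j))) refl ⟩
  (+ (2 ^ suc n * eulerSum (suc n) j)) / 2 ^ suc n   ≡⟨ cancel-/ (2 ^ suc n) (eulerSum (suc n) j) ⟩
  (+ eulerSum (suc n) j) / 1                         ∎
  where
  open ≡-Reasoning
  instance
    2^n≢0 : NonZero (2 ^ suc n)
    2^n≢0 = m^n≢0 2 (suc n)
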